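{- Let $n$ be a positive integer with binary representation $n = \sum_{k \ge 0} a_k 2^k$ (each $a_k \in \{0,1\}$, all but finitely many zero). Let $i \in \{1,3,5,7\}$ and let $k \ge 0$ be an integer. Then $$A_{i,k}(n) \equiv \begin{cases} a_{k+3} \pmod 2, & \text{if } \sum_{j=k}^{k+2} 2^{j-k} a_j < i,\\ a_{k+3}+1 \pmod 2, & \text{if } \sum_{j=k}^{k+2} 2^{j-k} a_j \ge i.\end{cases}$$
   Context: For $i \in \{1,3,5,7\}$ and integers $k \ge 0$, $A_{i,k}(n) := \#\{x \ge 1 : x \equiv i \pmod 8,\ 2^k x \le n\}$. -}

module Defs where

open import Data.Nat using (ℕ; zero; suc; _+_; _*_; _^_; _≤_; _<_; _≤ᵇ_; _≡ᵇ_)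
open import Data.Nat.DivMod using (_/_; _%_)
open import Data.Bool using (Bool; true; false; _∧_; if_then_else_)
open import Data.List using (List; length; filter; upTo; map)
open import Relation.Binary.PropositionalEquality using (_≡_)
open import Relation.Nullary.Decidable using (Dec; _×-dec_)
open import Data.Nat using (_≟_; _≤?_)
open import Data.Product using (_×_)

digit : ℕ → ℕ → ℕ
digit n zero = n % 2
digit n (suc j) = digit (n / 2) j

-- A_{i,k}(n) = #{ x ≥ 1 : x ≡ i (mod 8), 2^k x ≤ n }.
-- Any such x satisfies x ≤ 2^k x ≤ n, so x ranges over 1..n.
A : ℕ → ℕ → ℕ → ℕ
A i k n = length (filter (λ x → (x % 8 ≟ i % 8) ×-dec ((2 ^ k) * x ≤? n))
                         (map suc (upTo n)))

{-# OPTIONS --safe #-}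
-- Since 2^k x ≤ n iff x ≤ m := ⌊n / 2^k⌋, A_{i,k}(n) counts the x ∈ [1, m] with x ≡ i (mod 8).
-- Write m = 8q + r where r = a_k + 2a_{k+1} + 4a_{k+2} < 8 and q ≡ a_{k+3} (mod 2).  Every full
-- block of 8 consecutive integers contains exactly one such x, and [1, r] contains one iff
-- i ≤ r, because 0 < i < 8; hence A_{i,k}(n) = q + [i ≤ r].
module Submission where

open import Defs
open import Data.Bool using (Bool; true; false; _∧_)
open import Data.Bool.Properties using (∧-identityʳ; ∧-zeroʳ)
open import Data.Nat
  using (ℕ; zero; suc; _+_; _*_; _^_; _⊓_; _<ᵇ_; _≡ᵇ_; _<_; _≤_; _≥_; _≟_; _≤?_; s≤s; z<s; NonZero)
open import Data.Nat.Properties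
open import Data.Nat.DivMod
open import Data.List using ([_]; _++_; length; filter; upTo; map)
open import Data.List.Properties using (upTo-∷ʳ; map-++; filter-++; length-++)
open import Data.Nat.Tactic.RingSolver using (solve-∀)
open import Data.Product using (_×_; _,_; proj₁; proj₂)
open import Data.Sum using (_⊎_; inj₁; inj₂)
open import Data.Unit using (tt)
open import Function using (_⇔_; mk⇔)
open import Function.Properties.Equivalence using () renaming (trans to ⇔-trans)
open import Relation.Nullary using (Dec; does; yes; no)
open import Relation.Nullary.Decidable using (_×-dec_; dec-true; dec-false; does-⇔)
open import Relation.Binary.PropositionalEquality using (_≡_; refl; sym; trans; cong; subst; cong₂; module ≡-Reasoning)
open ≡-Reasoning

indicator : Bool → ℕ
indicator true = 1
indicator false = 0

count : (ℕ → Bool) → ℕ → ℕ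
count P zero = 0
count P (suc N) = count P N + indicator (P (suc N))

module _ {p} {Q : ℕ → Set p} (Q? : (x : ℕ) → Dec (Q x)) where

  length-filter-singleton : ∀ x → length (filter Q? [ x ]) ≡ indicator (does (Q? x))
  length-filter-singleton x with does (Q? x)
  ... | true = refl
  ... | false = refl

  length-filter-upTo : ∀ N →
    length (filter Q? (map suc (upTo N))) ≡ count (λ x → does (Q? x)) N
  length-filter-upTo zero = refl
  length-filter-upTo (suc N) = begin
    length (filter Q? (map suc (upTo (suc N))))
      ≡⟨ cong (λ xs → length (filter Q? (map suc xs))) (upTo-∷ʳ N) ⟨
    length (filter Q? (map suc (upTo N ++ [ N ])))
      ≡⟨ cong (λ xs → length (filter Q? xs)) (map-++ suc (upTo N) [ N ]) ⟩
    length (filter Q? (map suc (upTo N) ++ [ suc N ]))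
      ≡⟨ cong length (filter-++ Q? (map suc (upTo N)) [ suc N ]) ⟩
    length (filter Q? (map suc (upTo N)) ++ filter Q? [ suc N ])
      ≡⟨ length-++ (filter Q? (map suc (upTo N))) ⟩
    length (filter Q? (map suc (upTo N))) + length (filter Q? [ suc N ])
      ≡⟨ cong₂ _+_ (length-filter-upTo N) (length-filter-singleton (suc N)) ⟩
    count (λ x → does (Q? x)) (suc N) ∎

count-cong : ∀ {P Q} N → (∀ x → x ≤ N → P x ≡ Q x) → count P N ≡ count Q N
count-cong zero eq = refl
count-cong (suc N) eq =
  cong₂ _+_ (count-cong N (λ x x≤N → eq x (m≤n⇒m≤1+n x≤N))) (cong indicator (eq (suc N) ≤-refl))

count-∧-≤ : ∀ P m N → count (λ x → P x ∧ does (x ≤? m)) N ≡ count P (N ⊓ m)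
count-∧-≤ P m zero = refl
count-∧-≤ P m (suc N) with suc N ≤? m
... | yes N<m = begin
  count (λ x → P x ∧ does (x ≤? m)) N + indicator (P (suc N) ∧ does (suc N ≤? m))
    ≡⟨ cong₂ _+_ (count-∧-≤ P m N)
         (cong indicator (trans (cong (P (suc N) ∧_) (dec-true (suc N ≤? m) N<m))
                                (∧-identityʳ (P (suc N))))) ⟩
  count P (N ⊓ m) + indicator (P (suc N))
    ≡⟨ cong (λ l → count P l + indicator (P (suc N))) (m≤n⇒m⊓n≡m (<⇒≤ N<m)) ⟩
  count P (suc N)
    ≡⟨ cong (count P) (m≤n⇒m⊓n≡m N<m) ⟨
  count P (suc N ⊓ m) ∎
... | no N≮m = begin
  count (λ x → P x ∧ does (x ≤? m)) N + indicator (P (suc N) ∧ does (suc N ≤? m))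
    ≡⟨ cong₂ _+_ (count-∧-≤ P m N)
         (cong indicator (trans (cong (P (suc N) ∧_) (dec-false (suc N ≤? m) N≮m))
                                (∧-zeroʳ (P (suc N))))) ⟩
  count P (N ⊓ m) + 0
    ≡⟨ +-identityʳ _ ⟩
  count P (N ⊓ m)
    ≡⟨ cong (count P) (trans (m≥n⇒m⊓n≡n m≤N) (sym (m≥n⇒m⊓n≡n (m≤n⇒m≤1+n m≤N)))) ⟩
  count P (suc N ⊓ m) ∎
  where m≤N = ≮⇒≥ N≮m

module _ (P : ℕ → Bool) (p : ℕ) (periodic : ∀ x → P (p + x) ≡ P x) where

  count-+-period : ∀ N → count P (p + N) ≡ count P p + count P N
  count-+-period zero = trans (cong (count P) (+-identityʳ p)) (sym (+-identityʳ _))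
  count-+-period (suc N) = begin
    count P (p + suc N)
      ≡⟨ cong (count P) (+-suc p N) ⟩
    count P (p + N) + indicator (P (suc (p + N)))
      ≡⟨ cong₂ _+_ (count-+-period N)
               (cong indicator (trans (cong P (sym (+-suc p N))) (periodic (suc N)))) ⟩
    count P p + count P N + indicator (P (suc N))
      ≡⟨ +-assoc (count P p) _ _ ⟩
    count P p + count P (suc N) ∎

  count-*-period : ∀ q r → count P (q * p + r) ≡ q * count P p + count P r
  count-*-period zero r = refl
  count-*-period (suc q) r = begin
    count P (p + q * p + r)                  ≡⟨ cong (count P) (+-assoc p (q * p) r) ⟩
    count P (p + (q * p + r))                ≡⟨ count-+-period (q * p + r) ⟩
    count P p + count P (q * p + r)          ≡⟨ cong (count P p +_) (count-*-period q r) ⟩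
    count P p + (q * count P p + count P r)  ≡⟨ +-assoc (count P p) _ _ ⟨
    suc q * count P p + count P r            ∎

-- does (x ≟ y) and does (x ≤? y) compute to x ≡ᵇ y and x ≤ᵇ y, and suc c ≤ᵇ r to c <ᵇ r.
indicator-<ᵇ-suc : ∀ c r → indicator (c <ᵇ r) + indicator (r ≡ᵇ c) ≡ indicator (c <ᵇ suc r)
indicator-<ᵇ-suc zero zero = refl
indicator-<ᵇ-suc zero (suc r) = refl
indicator-<ᵇ-suc (suc c) zero = refl
indicator-<ᵇ-suc (suc c) (suc r) = indicator-<ᵇ-suc c r

count-≟ : ∀ c r → count (λ x → does (x ≟ suc c)) r ≡ indicator (does (suc c ≤? r))
count-≟ c zero = refl
count-≟ c (suc r) =
  trans (cong (_+ indicator (r ≡ᵇ c)) (count-≟ c r)) (indicator-<ᵇ-suc c r)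

count-%-≟ : ∀ p .{{_ : NonZero p}} c r → r < p →
  count (λ x → does (x % p ≟ suc c)) r ≡ indicator (does (suc c ≤? r))
count-%-≟ p c r r<p = trans
  (count-cong r (λ x x≤r → cong (λ y → does (y ≟ suc c)) (m<n⇒m%n≡m (≤-<-trans x≤r r<p))))
  (count-≟ c r)

count-%-≟-period : ∀ p c → c < p → count (λ x → does (x % suc p ≟ suc c)) (suc p) ≡ 1
count-%-≟-period p c c<p = begin
  count (λ x → does (x % suc p ≟ suc c)) p + indicator (does (suc p % suc p ≟ suc c))
    ≡⟨ cong₂ _+_ (count-%-≟ (suc p) c p ≤-refl)
                 (cong (λ y → indicator (does (y ≟ suc c))) (n%n≡0 (suc p))) ⟩
  indicator (does (suc c ≤? p)) + 0
    ≡⟨ cong (λ b → indicator b + 0) (dec-true (suc c ≤? p) c<p) ⟩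
  1 ∎

count-residue : ∀ {p c} .{{_ : NonZero p}} → 0 < c → c < p → ∀ q r → r < p →
  count (λ x → does (x % p ≟ c)) (q * p + r) ≡ q + indicator (does (c ≤? r))
count-residue {suc p} {suc c} _ (s≤s c<p) q r r<p = begin
  count R (q * suc p + r)
    ≡⟨ count-*-period R (suc p) periodic q r ⟩
  q * count R (suc p) + count R r
    ≡⟨ cong₂ _+_ (trans (cong (q *_) (count-%-≟-period p c c<p)) (*-identityʳ q))
                 (count-%-≟ (suc p) c r r<p) ⟩
  q + indicator (does (suc c ≤? r)) ∎
  where
  R : ℕ → Bool
  R x = does (x % suc p ≟ suc c)
  periodic : ∀ x → R (suc p + x) ≡ R x
  periodic x = cong (λ y → does (y ≟ suc c))
    (trans (cong (_% suc p) (+-comm (suc p) x)) ([m+n]%n≡m%n x (suc p)))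

*≤⇔≤/ : ∀ d x n .{{_ : NonZero d}} → d * x ≤ n ⇔ x ≤ n / d
*≤⇔≤/ d x n = mk⇔
  (λ dx≤n → subst (_≤ n / d) (trans (cong (_/ d) (*-comm d x)) (m*n/n≡m x d)) (/-monoˡ-≤ d dx≤n))
  (λ x≤n/d → ≤-trans (*-monoʳ-≤ d x≤n/d) (subst (_≤ n) (*-comm (n / d) d) (m/n*n≤m n d)))

infixl 7 _/2^_
_/2^_ : ℕ → ℕ → ℕ
n /2^ zero = n
n /2^ suc k = n / 2 /2^ k

/2^-≤ : ∀ n k → n /2^ k ≤ n
/2^-≤ n zero = ≤-refl
/2^-≤ n (suc k) = ≤-trans (/2^-≤ (n / 2) k) (m/n≤m n 2)

≡⇒≤⇔≤ : ∀ {a b n} → a ≡ b → a ≤ n ⇔ b ≤ n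
≡⇒≤⇔≤ {n = n} a≡b = mk⇔ (subst (_≤ n) a≡b) (subst (_≤ n) (sym a≡b))

2^*≤⇔≤/2^ : ∀ k x n → 2 ^ k * x ≤ n ⇔ x ≤ n /2^ k
2^*≤⇔≤/2^ zero x n = ≡⇒≤⇔≤ (*-identityˡ x)
2^*≤⇔≤/2^ (suc k) x n =
  ⇔-trans (≡⇒≤⇔≤ (*-assoc 2 (2 ^ k) x))
          (⇔-trans (*≤⇔≤/ 2 (2 ^ k * x) n) (2^*≤⇔≤/2^ k x (n / 2)))

digit-+ : ∀ k j n → digit n (k + j) ≡ digit (n /2^ k) j
digit-+ zero j n = refl
digit-+ (suc k) j n = digit-+ k j (n / 2)

digit<2 : ∀ n j → digit n j < 2
digit<2 n zero = m%n<n n 2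
digit<2 n (suc j) = digit<2 (n / 2) j

digitBlock : ℕ → ℕ → ℕ
digitBlock n k = digit n k + 2 * digit n (k + 1) + 4 * digit n (k + 2)

digitBlock-/2^ : ∀ n k → digitBlock n k ≡ digitBlock (n /2^ k) 0
digitBlock-/2^ n k = cong₂ _+_
  (cong₂ _+_ (trans (cong (digit n) (sym (+-identityʳ k))) (digit-+ k 0 n))
             (cong (2 *_) (digit-+ k 1 n)))
  (cong (4 *_) (digit-+ k 2 n))

digitBlock<8 : ∀ n k → digitBlock n k < 8
digitBlock<8 n k =
  s≤s (+-mono-≤ (+-mono-≤ (bit k) (*-monoʳ-≤ 2 (bit (k + 1)))) (*-monoʳ-≤ 4 (bit (k + 2))))
  where
  bit : ∀ j → digit n j ≤ 1
  bit j = ≤-pred (digit<2 n j)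

m≡[m/2/2/2]*8+digitBlock : ∀ m → m ≡ m / 2 / 2 / 2 * 8 + digitBlock m 0
m≡[m/2/2/2]*8+digitBlock m = begin
  m
    ≡⟨ m≡m%n+[m/n]*n m 2 ⟩
  m % 2 + m / 2 * 2
    ≡⟨ cong (λ y → m % 2 + y * 2) (m≡m%n+[m/n]*n (m / 2) 2) ⟩
  m % 2 + (m / 2 % 2 + m / 2 / 2 * 2) * 2
    ≡⟨ cong (λ y → m % 2 + (m / 2 % 2 + y * 2) * 2) (m≡m%n+[m/n]*n (m / 2 / 2) 2) ⟩
  m % 2 + (m / 2 % 2 + (m / 2 / 2 % 2 + m / 2 / 2 / 2 * 2) * 2) * 2
    ≡⟨ regroup (m % 2) (m / 2 % 2) (m / 2 / 2 % 2) (m / 2 / 2 / 2) ⟩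
  m / 2 / 2 / 2 * 8 + digitBlock m 0 ∎
  where
  regroup : ∀ a b c q → a + (b + (c + q * 2) * 2) * 2 ≡ q * 8 + (a + 2 * b + 4 * c)
  regroup = solve-∀

A≡quotient+indicator : ∀ i k n → 0 < i → i < 8 →
  A i k n ≡ n /2^ k / 2 / 2 / 2 + indicator (does (i ≤? digitBlock (n /2^ k) 0))
A≡quotient+indicator i k n 0<i i<8 = begin
  A i k n
    ≡⟨ length-filter-upTo (λ x → (x % 8 ≟ i % 8) ×-dec (2 ^ k * x ≤? n)) n ⟩
  count (λ x → does (x % 8 ≟ i % 8) ∧ does (2 ^ k * x ≤? n)) n
    ≡⟨ count-cong n (λ x _ → cong₂ _∧_ (cong (λ c → does (x % 8 ≟ c)) (m<n⇒m%n≡m i<8))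
                                        (does-⇔ (2^*≤⇔≤/2^ k x n) (2 ^ k * x ≤? n) (x ≤? m))) ⟩
  count (λ x → R x ∧ does (x ≤? m)) n
    ≡⟨ count-∧-≤ R m n ⟩
  count R (n ⊓ m)
    ≡⟨ cong (count R) (m≥n⇒m⊓n≡n (/2^-≤ n k)) ⟩
  count R m
    ≡⟨ cong (count R) (m≡[m/2/2/2]*8+digitBlock m) ⟩
  count R (m / 2 / 2 / 2 * 8 + digitBlock m 0)
    ≡⟨ count-residue 0<i i<8 (m / 2 / 2 / 2) (digitBlock m 0) (digitBlock<8 m 0) ⟩
  m / 2 / 2 / 2 + indicator (does (i ≤? digitBlock m 0)) ∎
  where
  m : ℕ
  m = n /2^ k
  R : ℕ → Bool
  R x = does (x % 8 ≟ i)

[m+n]%d≡[m%d+n]%d : ∀ m n d .{{_ : NonZero d}} → (m + n) % d ≡ (m % d + n) % d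
[m+n]%d≡[m%d+n]%d m n d = begin
  (m + n) % d              ≡⟨ %-distribˡ-+ m n d ⟩
  (m % d + n % d) % d      ≡⟨ cong (λ y → (y + n % d) % d) (m%n%n≡m%n m d) ⟨
  (m % d % d + n % d) % d  ≡⟨ %-distribˡ-+ (m % d) n d ⟨
  (m % d + n) % d          ∎

A-mod-2 : ∀ i k n → 0 < i → i < 8 →
  A i k n % 2 ≡ (digit n (k + 3) + indicator (does (i ≤? digitBlock n k))) % 2
A-mod-2 i k n 0<i i<8 = begin
  A i k n % 2
    ≡⟨ cong (_% 2) (A≡quotient+indicator i k n 0<i i<8) ⟩
  (m / 2 / 2 / 2 + indicator (does (i ≤? digitBlock m 0))) % 2
    ≡⟨ [m+n]%d≡[m%d+n]%d (m / 2 / 2 / 2) _ 2 ⟩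
  (digit m 3 + indicator (does (i ≤? digitBlock m 0))) % 2
    ≡⟨ cong₂ (λ a b → (a + indicator (does (i ≤? b))) % 2) (digit-+ k 3 n) (digitBlock-/2^ n k) ⟨
  (digit n (k + 3) + indicator (does (i ≤? digitBlock n k))) % 2 ∎
  where
  m : ℕ
  m = n /2^ k

odd<8 : ∀ {i} → i ≡ 1 ⊎ i ≡ 3 ⊎ i ≡ 5 ⊎ i ≡ 7 → 0 < i × i < 8
odd<8 (inj₁ refl)                 = z<s , <ᵇ⇒< 1 8 tt
odd<8 (inj₂ (inj₁ refl))          = z<s , <ᵇ⇒< 3 8 tt
odd<8 (inj₂ (inj₂ (inj₁ refl)))   = z<s , <ᵇ⇒< 5 8 tt
odd<8 (inj₂ (inj₂ (inj₂ refl)))   = z<s , <ᵇ⇒< 7 8 tt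

lemma6 : (n i k : ℕ) → 1 ≤ n →
    (i ≡ 1 ⊎ i ≡ 3 ⊎ i ≡ 5 ⊎ i ≡ 7) →
    (digit n k + 2 * digit n (k + 1) + 4 * digit n (k + 2) < i →
      A i k n % 2 ≡ digit n (k + 3) % 2)
    × (digit n k + 2 * digit n (k + 1) + 4 * digit n (k + 2) ≥ i →
      A i k n % 2 ≡ (digit n (k + 3) + 1) % 2)
lemma6 n i k _ i-odd = below , above
  where
  parity : A i k n % 2 ≡ (digit n (k + 3) + indicator (does (i ≤? digitBlock n k))) % 2
  parity = A-mod-2 i k n (proj₁ (odd<8 i-odd)) (proj₂ (odd<8 i-odd))
  indicatorAs : ∀ {b} → does (i ≤? digitBlock n k) ≡ b →
    A i k n % 2 ≡ (digit n (k + 3) + indicator b) % 2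
  indicatorAs eq = trans parity (cong (λ b → (digit n (k + 3) + indicator b) % 2) eq)
  below : digitBlock n k < i → A i k n % 2 ≡ digit n (k + 3) % 2
  below S<i = trans (indicatorAs (dec-false (i ≤? digitBlock n k) (<⇒≱ S<i)))
                    (cong (_% 2) (+-identityʳ (digit n (k + 3))))
  above : digitBlock n k ≥ i → A i k n % 2 ≡ (digit n (k + 3) + 1) % 2
  above i≤S = indicatorAs (dec-true (i ≤? digitBlock n k) i≤S)
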